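{- Fix an integer $k\ge4$. Let $G$ be a graph with $\Delta(G)\le k$ and $\chi_\ell(G^2)>k+1$ that has the minimum number of vertices among all graphs $H$ with $\Delta(H)\le k$ and $\chi_\ell(H^2)>k+1$. Then $G$ contains none of the following: (A) a vertex of degree at most $1$; (B) a path $\langle x,u,v,y\rangle$ with $d(u)=d(v)=2$, $d(x)\le k-1$ and $d(y)\le k-2$; (C) a cycle whose length is divisible by $4$ such that, going around the cycle, every fourth vertex has degree $k$ in $G$ and all other vertices of the cycle have degree $2$ in $G$ (i.e., a cycle composed of $3$-threads whose endpoints have degree $k$).
   Context: Graphs are finite and simple; $d(v)$ is the degree of $v$ in $G$ and $\Delta(G)$ the maximum degree. $G^2$ is the graph on $V(G)$ in which two vertices are adjacent when their distance in $G$ is $1$ or $2$. $\chi_\ell(H)$ is the list chromatic number: the least $k$ such that for every assignment of lists of size $k$ to the vertices, a proper coloring choosing each vertex's color from its list exists. -}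

module Defs where

open import Data.Nat using (ℕ; zero; suc; _+_; _*_; _∸_; _≤_; _<_; _%_)
open import Data.Fin using (Fin; toℕ)
open import Data.Bool using (Bool; true; false; _∧_)
open import Data.List using (List; length; filterᵇ; allFin)
open import Data.List.Membership.Propositional using (_∈_)
open import Data.List.Relation.Unary.Unique.Propositional using (Unique)
open import Data.Product using (Σ; _×_; ∃)
open import Data.Sum using (_⊎_)
open import Relation.Binary.PropositionalEquality using (_≡_; _≢_)
open import Relation.Nullary using (¬_)

record Graph (n : ℕ) : Set where
  field
    adj   : Fin n → Fin n → Bool
    sym   : ∀ u v → adj u v ≡ adj v u
    irrefl : ∀ v → adj v v ≡ false
open Graph public

Adj : ∀ {n} → Graph n → Fin n → Fin n → Set
Adj G u v = adj G u v ≡ true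

deg : ∀ {n} → Graph n → Fin n → ℕ
deg {n} G v = length (filterᵇ (adj G v) (allFin n))

MaxDegLe : ∀ {n} → Graph n → ℕ → Set
MaxDegLe G k = ∀ v → deg G v ≤ k

Adj² : ∀ {n} → Graph n → Fin n → Fin n → Set
Adj² G u v = u ≢ v × (Adj G u v ⊎ ∃ λ w → Adj G u w × Adj G w v)

ListAssignment : ℕ → ℕ → Set
ListAssignment n m = Σ (Fin n → List ℕ) λ L → ∀ v → Unique (L v) × length (L v) ≡ m

Choosable : ∀ {n} → (Fin n → Fin n → Set) → ℕ → Set
Choosable {n} R m =
  (L : ListAssignment n m) →
  Σ (Fin n → ℕ) λ c → (∀ v → c v ∈ Data.Product.proj₁ L v) × (∀ u v → R u v → c u ≢ c v)

ListChromGt : ∀ {n} → (Fin n → Fin n → Set) → ℕ → Set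
ListChromGt R t = ∀ m → m ≤ t → ¬ Choosable R m

Bad : ∀ {n} → ℕ → Graph n → Set
Bad k G = MaxDegLe G k × ListChromGt (Adj² G) (suc k)

MinimalBad : ∀ {n} → ℕ → Graph n → Set
MinimalBad {n} k G = Bad k G × (∀ m (H : Graph m) → Bad k H → n ≤ m)

ConfigB : ∀ {n} → ℕ → Graph n → Set
ConfigB {n} k G =
  Σ (Fin n) λ x → Σ (Fin n) λ u → Σ (Fin n) λ v → Σ (Fin n) λ y →
    (x ≢ u × x ≢ v × x ≢ y × u ≢ v × u ≢ y × v ≢ y) ×
    (Adj G x u × Adj G u v × Adj G v y) ×
    (deg G u ≡ 2 × deg G v ≡ 2 × deg G x ≤ k ∸ 1 × deg G y ≤ k ∸ 2)

ConfigC : ∀ {n} → ℕ → Graph n → Set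
ConfigC {n} k G =
  Σ ℕ λ t → Σ (Fin (4 * suc t) → Fin n) λ c →
    (∀ i j → c i ≡ c j → i ≡ j) ×
    (∀ i j → toℕ j ≡ suc (toℕ i) % (4 * suc t) → Adj G (c i) (c j)) ×
    (∀ i → (toℕ i % 4 ≡ 0 → deg G (c i) ≡ k) × (toℕ i % 4 ≢ 0 → deg G (c i) ≡ 2))

-- Each configuration yields a vertex set S that is reducible: for some r in S,
-- G - r is smaller than G and has maximum degree at most k, so by minimality its
-- square is (k+1)-choosable. As r has at most one neighbour outside S, such a
-- colouring is proper on the square of G restricted to the vertices outside S, and
-- it extends to S, contradicting the choice of G.
--   (A) A vertex of degree at most 1 has at most k vertices within distance 2.
--   (B) Colouring u before v, each of the two inner vertices of the path sees at
--       most k coloured vertices within distance 2.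
--   (C) Take S to be the degree-2 vertices of the cycle.
--       Each thread middle then sees only four coloured vertices.

module Submission where

open import Defs hiding (sym)
open import Data.Bool using (true)
import Data.Bool as Bool
open import Data.Bool.Properties using (T-≡)
open import Data.Fin using (Fin; punchIn; punchOut; toℕ; fromℕ<) renaming (_≟_ to _≟ᶠ_)
open import Data.Fin.Properties using (punchIn-injective; punchIn-punchOut; any?; toℕ-fromℕ<; toℕ-injective; toℕ<n)
open import Data.List using (List; []; _∷_; _++_; length; filter; filterᵇ; map; take; allFin)
open import Data.List.Properties using (length-++; length-++-sucʳ; length-map; length-take)
open import Data.List.Membership.Propositional using (_∈_; _∉_; find)
open import Data.List.Membership.Propositional.Properties
  using (∈-∃++; ∈-++⁻; ∈-++⁺ˡ; ∈-++⁺ʳ; ∈-filter⁺; ∈-filter⁻; ∈-map⁺; ∈-map⁻; ∈-allFin)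
import Data.List.Membership.DecPropositional as DecMembership
open import Data.List.Relation.Binary.Subset.Propositional using (_⊆_)
open import Data.List.Relation.Unary.All as All using (All; []; _∷_)
open import Data.List.Relation.Unary.All.Properties using (¬All⇒Any¬)
open import Data.List.Relation.Unary.Any using (here; there)
open import Data.List.Relation.Unary.AllPairs using ([]; _∷_)
open import Data.List.Relation.Unary.Unique.Propositional using (Unique)
import Data.List.Relation.Unary.Unique.Propositional.Properties as Unique
import Data.List.Relation.Binary.Sublist.Propositional as Sublist
import Data.List.Relation.Binary.Sublist.Propositional.Properties as Sublist
open import Data.Nat using (ℕ; zero; suc; _+_; _*_; _∸_; _%_; _≤?_; _≟_; _/_; ⌊_/2⌋; ⌈_/2⌉; _≤_; _<_; z≤n; s≤s; NonZero; pred)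
open import Data.Nat.Divisibility using (divides)
open import Data.Nat.DivMod using (%-distribˡ-+; m%n%n≡m%n; [m+n]%n≡m%n; [m+kn]%n≡m%n; m%n<n; m<n⇒m%n≡m; n%n≡0; m*n%n≡0; m∣n⇒o%n%m≡o%m; m≡m%n+[m/n]*n; m<n*o⇒m/o<n)
open import Data.Nat.Properties using (≰⇒>; m≤n⇒∃[o]m+o≡n; m+n∸m≡n; +-identityʳ; <-irrefl; m≤m+n; ≤-trans; ≤-refl; <⇒≱; n≤1+n; m≤n⇒m⊓n≡m; 1+n≰n; 0≢1+n; +-comm; +-monoʳ-≤; *-suc; *-assoc; *-monoʳ-≤; ≤-reflexive; ≤-pred; ⌈n/2⌉-mono; ⌊n/2⌋-mono; *-cancelˡ-≡; +-cancelˡ-≡; m≤n⇒m<n∨m≡n; *-comm; +-suc)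
import Data.Nat.Properties as ℕ
open import Data.Product using (Σ; ∃; _×_; _,_; proj₁; proj₂)
open import Data.Sum using (_⊎_; inj₁; inj₂; [_,_])
open import Data.Vec.Functional using (insertAt)
open import Data.Vec.Functional.Properties using (insertAt-punchIn)
open import Function using (_∘_; Equivalence)
open import Relation.Binary.Definitions using (DecidableEquality)
open import Relation.Binary.PropositionalEquality
  using (_≡_; _≢_; refl; sym; trans; cong; subst; subst₂; module ≡-Reasoning)
open import Relation.Nullary using (¬_; yes; no; Dec; contradiction)
open import Relation.Nullary.Decidable using (T?; ¬?; _⊎-dec_; _×-dec_)
open import Relation.Unary using (Decidable)

module _ {A : Set} where

  Unique∧⊆⇒length≤ : {xs ys : List A} → Unique xs → xs ⊆ ys → length xs ≤ length ys
  Unique∧⊆⇒length≤ {[]} _ _ = z≤n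
  Unique∧⊆⇒length≤ {x ∷ xs} (x∉xs ∷ uxs) xs⊆ys with ∈-∃++ (xs⊆ys (here refl))
  ... | as , bs , refl = subst (suc (length xs) ≤_) (sym (length-++-sucʳ as x bs))
                           (s≤s (Unique∧⊆⇒length≤ uxs xs⊆as++bs))
    where
      xs⊆as++bs : xs ⊆ as ++ bs
      xs⊆as++bs {z} z∈xs with ∈-++⁻ as (xs⊆ys (there z∈xs))
      ... | inj₁ z∈as = ∈-++⁺ˡ z∈as
      ... | inj₂ (here z≡x) = contradiction (sym z≡x) (All.lookup x∉xs z∈xs)
      ... | inj₂ (there z∈bs) = ∈-++⁺ʳ as z∈bs

  module _ (_≟_ : DecidableEquality A) where
    open DecMembership _≟_ using (_∈?_)

    longer⇒∃∉ : {xs ys : List A} → Unique xs → length ys < length xs → ∃ λ x → x ∈ xs × x ∉ ys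
    longer⇒∃∉ {xs} {ys} uxs ys<xs =
      find (¬All⇒Any¬ (_∈? ys) xs λ all∈ys → <⇒≱ ys<xs (Unique∧⊆⇒length≤ uxs (All.lookup all∈ys)))

    longer⇒∃₂∉ : {xs ys : List A} → Unique xs → 2 + length ys ≤ length xs →
                 ∃ λ x → ∃ λ y → x ≢ y × (x ∈ xs × x ∉ ys) × (y ∈ xs × y ∉ ys)
    longer⇒∃₂∉ uxs ys<xs with longer⇒∃∉ uxs (≤-trans (s≤s (n≤1+n _)) ys<xs)
    ... | x , x∈xs , x∉ys with longer⇒∃∉ uxs ys<xs
    ... | y , y∈xs , y∉x∷ys = x , y , (λ x≡y → y∉x∷ys (here (sym x≡y))) , (x∈xs , x∉ys) , (y∈xs , y∉x∷ys ∘ there)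

  length-filter-∁ : {P : A → Set} (P? : Decidable P) {xs ys : List A} → Unique xs → Unique ys → ys ⊆ xs →
                    All (¬_ ∘ P) ys → length ys + length (filter P? xs) ≤ length xs
  length-filter-∁ P? {xs} {ys} uxs uys ys⊆xs ¬Pys =
    subst (_≤ length xs) (length-++ ys)
      (Unique∧⊆⇒length≤ (Unique.++⁺ uys (Unique.filter⁺ P? uxs) disjoint) ys++fxs⊆xs)
    where
      disjoint : ∀ {v} → ¬ (v ∈ ys × v ∈ filter P? xs)
      disjoint (v∈ys , v∈fxs) = All.lookup ¬Pys v∈ys (proj₂ (∈-filter⁻ P? {xs = xs} v∈fxs))
      ys++fxs⊆xs : ys ++ filter P? xs ⊆ xs
      ys++fxs⊆xs v∈ with ∈-++⁻ ys v∈
      ... | inj₁ v∈ys = ys⊆xs v∈ys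
      ... | inj₂ v∈fxs = proj₁ (∈-filter⁻ P? {xs = xs} v∈fxs)

module _ {n : ℕ} (G : Graph n) where

  nbrs : Fin n → List (Fin n)
  nbrs v = filterᵇ (adj G v) (allFin n)

  Adj⇒∈nbrs : ∀ {v w} → Adj G v w → w ∈ nbrs v
  Adj⇒∈nbrs {v} {w} v~w = ∈-filter⁺ (T? ∘ adj G v) (∈-allFin w) (Equivalence.from T-≡ v~w)

  ∈nbrs⇒Adj : ∀ {v w} → w ∈ nbrs v → Adj G v w
  ∈nbrs⇒Adj {v} w∈ = Equivalence.to T-≡ (proj₂ (∈-filter⁻ (T? ∘ adj G v) {xs = allFin n} w∈))

  nbrs-unique : ∀ v → Unique (nbrs v)
  nbrs-unique v = Unique.filter⁺ (T? ∘ adj G v) (Unique.allFin⁺ n)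

  Adj-sym : ∀ {u v} → Adj G u v → Adj G v u
  Adj-sym {u} {v} u~v = trans (Graph.sym G v u) u~v

  Adj²-sym : ∀ {u v} → Adj² G u v → Adj² G v u
  Adj²-sym (u≢v , inj₁ u~v) = u≢v ∘ sym , inj₁ (Adj-sym u~v)
  Adj²-sym (u≢v , inj₂ (w , u~w , w~v)) = u≢v ∘ sym , inj₂ (w , Adj-sym w~v , Adj-sym u~w)

  Unique∧Adj⇒length≤deg : ∀ {v xs} → Unique xs → (∀ {w} → w ∈ xs → Adj G v w) → length xs ≤ deg G v
  Unique∧Adj⇒length≤deg uxs all-adj = Unique∧⊆⇒length≤ uxs (Adj⇒∈nbrs ∘ all-adj)

  deg≤1⇒Adj-unique : ∀ {v a b} → deg G v ≤ 1 → Adj G v a → Adj G v b → a ≡ b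
  deg≤1⇒Adj-unique {a = a} {b} d≤1 v~a v~b with a ≟ᶠ b
  ... | yes a≡b = a≡b
  ... | no a≢b = contradiction (≤-trans (Unique∧Adj⇒length≤deg uniq ∈⇒Adj) d≤1) λ { (s≤s ()) }
    where
      uniq : Unique (a ∷ b ∷ [])
      uniq = (a≢b ∷ []) ∷ [] ∷ []
      ∈⇒Adj : ∀ {w} → w ∈ a ∷ b ∷ [] → Adj G _ w
      ∈⇒Adj (here refl) = v~a
      ∈⇒Adj (there (here refl)) = v~b

  deg≡2⇒Adj-either : ∀ {v a b z} → deg G v ≡ 2 → a ≢ b → Adj G v a → Adj G v b → Adj G v z → z ≡ a ⊎ z ≡ b
  deg≡2⇒Adj-either {a = a} {b} {z} d≡2 a≢b v~a v~b v~z with z ≟ᶠ a | z ≟ᶠ b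
  ... | yes z≡a | _ = inj₁ z≡a
  ... | no _ | yes z≡b = inj₂ z≡b
  ... | no z≢a | no z≢b =
    contradiction (subst (3 ≤_) d≡2 (Unique∧Adj⇒length≤deg uniq ∈⇒Adj)) λ { (s≤s (s≤s ())) }
    where
      uniq : Unique (z ∷ a ∷ b ∷ [])
      uniq = (z≢a ∷ z≢b ∷ []) ∷ (a≢b ∷ []) ∷ [] ∷ []
      ∈⇒Adj : ∀ {w} → w ∈ z ∷ a ∷ b ∷ [] → Adj G _ w
      ∈⇒Adj (here refl) = v~z
      ∈⇒Adj (there (here refl)) = v~a
      ∈⇒Adj (there (there (here refl))) = v~b

  length-filter-nbrs : ∀ {S : Fin n → Set} (S? : Decidable S) {v xs} → Unique xs →
                       (∀ {w} → w ∈ xs → Adj G v w × S w) →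
                       length xs + length (filter (¬? ∘ S?) (nbrs v)) ≤ deg G v
  length-filter-nbrs S? uxs adj∧S =
    length-filter-∁ (¬? ∘ S?) (nbrs-unique _) uxs (Adj⇒∈nbrs ∘ proj₁ ∘ adj∧S)
      (All.tabulate λ w∈ ¬Sw → ¬Sw (proj₂ (adj∧S w∈)))

deleteVertex : ∀ {n} → Graph (suc n) → Fin (suc n) → Graph n
deleteVertex G r = record
  { adj = λ i j → adj G (punchIn r i) (punchIn r j)
  ; sym = λ i j → Graph.sym G (punchIn r i) (punchIn r j)
  ; irrefl = λ i → irrefl G (punchIn r i)
  }

deg-deleteVertex : ∀ {n} (G : Graph (suc n)) r i → deg (deleteVertex G r) i ≤ deg G (punchIn r i)
deg-deleteVertex G r i =
  subst (_≤ deg G (punchIn r i)) (length-map (punchIn r) (nbrs H i))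
    (Unique∧Adj⇒length≤deg G (Unique.map⁺ (punchIn-injective r _ _) (nbrs-unique H i)) ∈⇒Adj)
  where
    H = deleteVertex G r
    ∈⇒Adj : ∀ {w} → w ∈ map (punchIn r) (nbrs H i) → Adj G (punchIn r i) w
    ∈⇒Adj w∈ with ∈-map⁻ (punchIn r) w∈
    ... | j , j∈ , refl = ∈nbrs⇒Adj H j∈

Colouring : ∀ {n m} → (Fin n → Fin n → Set) → ListAssignment n m → Set
Colouring {n} R L = Σ (Fin n → ℕ) λ c → (∀ v → c v ∈ proj₁ L v) × (∀ u v → R u v → c u ≢ c v)

Choosable-mono : ∀ {n a b} {R : Fin n → Fin n → Set} → a ≤ b → Choosable R a → Choosable R b
Choosable-mono {a = a} a≤b choose (L , L-ok) with choose (shortened , shortened-ok)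
  where
    shortened = λ v → take a (L v)
    shortened-ok = λ v → Unique.take⁺ a (proj₁ (L-ok v)) ,
      trans (length-take a (L v)) (m≤n⇒m⊓n≡m (subst (a ≤_) (sym (proj₂ (L-ok v))) a≤b))
... | c , c∈ , proper = c , (λ v → Sublist.lookup (Sublist.take-⊆ a (L v)) (c∈ v)) , proper

module PartialColouring {n m : ℕ} (G : Graph n) (L : ListAssignment n m) where

  ProperOutside : (Fin n → Set) → (Fin n → ℕ) → Set
  ProperOutside S c = (∀ v → ¬ S v → c v ∈ proj₁ L v) × (∀ u v → ¬ S u → ¬ S v → Adj² G u v → c u ≢ c v)

  ProperOutside-mono : ∀ {S S' c} → (∀ {v} → S v → S' v) → ProperOutside S c → ProperOutside S' c
  ProperOutside-mono S⊆S' (c∈ , proper) =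
    (λ v ¬S'v → c∈ v (¬S'v ∘ S⊆S')) , λ u v ¬S'u ¬S'v → proper u v (¬S'u ∘ S⊆S') (¬S'v ∘ S⊆S')

  ProperOutside-∅ : ∀ {S c} → (∀ v → ¬ S v) → ProperOutside S c → Colouring (Adj² G) L
  ProperOutside-∅ {c = c} ∅ (c∈ , proper) = c , (λ v → c∈ v (∅ v)) , λ u v → proper u v (∅ u) (∅ v)

  override : ∀ {T : Fin n → Set} → Decidable T → (Fin n → ℕ) → (Fin n → ℕ) → Fin n → ℕ
  override T? φ c v with T? v
  ... | yes _ = φ v
  ... | no _ = c v

  override-view : ∀ {T : Fin n → Set} (T? : Decidable T) φ c v →
                  (T v × override T? φ c v ≡ φ v) ⊎ (¬ T v × override T? φ c v ≡ c v)
  override-view T? φ c v with T? v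
  ... | yes Tv = inj₁ (Tv , refl)
  ... | no ¬Tv = inj₂ (¬Tv , refl)

  extend : ∀ {S T : Fin n → Set} (T? : Decidable T) {φ c} → ProperOutside S c →
           (∀ x → T x → φ x ∈ proj₁ L x) →
           (∀ x z → T x → ¬ S z → Adj² G x z → φ x ≢ c z) →
           (∀ x y → T x → T y → Adj² G x y → φ x ≢ φ y) →
           ProperOutside (λ v → S v × ¬ T v) (override T? φ c)
  extend {S} {T} T? {φ} {c} (c∈ , proper) φ∈ φ≢c φ≢φ = ∈L , proper'
    where
      ¬S∨T : ∀ {v} → ¬ (S v × ¬ T v) → ¬ T v → ¬ S v
      ¬S∨T ¬S∖T ¬Tv Sv = ¬S∖T (Sv , ¬Tv)
      ∈L : ∀ v → ¬ (S v × ¬ T v) → override T? φ c v ∈ proj₁ L v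
      ∈L v ¬S∖T with override-view T? φ c v
      ... | inj₁ (Tv , eq) = subst (_∈ proj₁ L v) (sym eq) (φ∈ v Tv)
      ... | inj₂ (¬Tv , eq) = subst (_∈ proj₁ L v) (sym eq) (c∈ v (¬S∨T ¬S∖T ¬Tv))
      proper' : ∀ u v → ¬ (S u × ¬ T u) → ¬ (S v × ¬ T v) → Adj² G u v →
                override T? φ c u ≢ override T? φ c v
      proper' u v ¬S∖Tu ¬S∖Tv u~v with override-view T? φ c u | override-view T? φ c v
      ... | inj₁ (Tu , equ) | inj₁ (Tv , eqv) rewrite equ | eqv = φ≢φ u v Tu Tv u~v
      ... | inj₁ (Tu , equ) | inj₂ (¬Tv , eqv) rewrite equ | eqv = φ≢c u v Tu (¬S∨T ¬S∖Tv ¬Tv) u~v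
      ... | inj₂ (¬Tu , equ) | inj₁ (Tv , eqv) rewrite equ | eqv =
        φ≢c v u Tv (¬S∨T ¬S∖Tu ¬Tu) (Adj²-sym G u~v) ∘ sym
      ... | inj₂ (¬Tu , equ) | inj₂ (¬Tv , eqv) rewrite equ | eqv =
        proper u v (¬S∨T ¬S∖Tu ¬Tu) (¬S∨T ¬S∖Tv ¬Tv) u~v

  module Greedy {S T : Fin n → Set} (T? : Decidable T) (F : ∀ x → T x → List (Fin n))
                (F<m : ∀ x Tx → length (F x Tx) < m)
                (F-covers : ∀ x Tx z → ¬ S z → Adj² G x z → z ∈ F x Tx)
                (T-independent : ∀ x y → T x → T y → ¬ Adj² G x y)
                {c : Fin n → ℕ} (c-ok : ProperOutside S c) where

    choice : ∀ x Tx → ∃ λ α → α ∈ proj₁ L x × α ∉ map c (F x Tx)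
    choice x Tx = longer⇒∃∉ ℕ._≟_ (proj₁ (proj₂ L x))
      (subst₂ _<_ (sym (length-map c (F x Tx))) (sym (proj₂ (proj₂ L x))) (F<m x Tx))

    φ : Fin n → ℕ
    φ x with T? x
    ... | yes Tx = proj₁ (choice x Tx)
    ... | no _ = 0

    φ∈ : ∀ x → T x → φ x ∈ proj₁ L x
    φ∈ x Tx with T? x
    ... | yes Tx' = proj₁ (proj₂ (choice x Tx'))
    ... | no ¬Tx = contradiction Tx ¬Tx

    φ≢c : ∀ x z → T x → ¬ S z → Adj² G x z → φ x ≢ c z
    φ≢c x z Tx ¬Sz x~z with T? x
    ... | yes Tx' = λ φx≡cz → proj₂ (proj₂ (choice x Tx'))
                      (subst (_∈ map c (F x Tx')) (sym φx≡cz) (∈-map⁺ c (F-covers x Tx' z ¬Sz x~z)))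
    ... | no ¬Tx = contradiction Tx ¬Tx

    colouring : ProperOutside (λ v → S v × ¬ T v) (override T? φ c)
    colouring = extend T? c-ok φ∈ φ≢c λ x y Tx Ty x~y _ → T-independent x y Tx Ty x~y

  extend-vertex : ∀ {S c} x (F : List (Fin n)) → length F < m → (∀ z → ¬ S z → Adj² G x z → z ∈ F) →
                  ProperOutside S c → ∃ λ c' → ProperOutside (λ v → S v × v ≢ x) c'
  extend-vertex x F F<m F-covers c-ok = _ , Greedy.colouring (_≟ᶠ x) (λ _ _ → F) (λ _ _ → F<m)
    (λ { _ refl z → F-covers z }) (λ { _ _ refl refl (x≢x , _) → x≢x refl }) c-ok

open PartialColouring using (ProperOutside; ProperOutside-mono; ProperOutside-∅; override; extend; extend-vertex; module Greedy)

Extendable : ∀ {n} → ℕ → Graph n → (Fin n → Set) → Set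
Extendable {n} m G S = ∀ (L : ListAssignment n m) {c} → ProperOutside G L S c → Colouring (Adj² G) L

AtMostOneNbrOutside : ∀ {n} → Graph n → (Fin n → Set) → Fin n → Set
AtMostOneNbrOutside G S r = ∀ {u v} → ¬ S u → ¬ S v → Adj G r u → Adj G r v → u ≡ v

Choosable-deleteVertex : ∀ {n m} {G : Graph (suc n)} {S r} → S r → AtMostOneNbrOutside G S r →
                         Extendable m G S → Choosable (Adj² (deleteVertex G r)) m → Choosable (Adj² G) m
Choosable-deleteVertex {n} {m} {G} {S} {r} Sr r-nbr extendable choose L = extendable L (c∈ , proper)
  where
    H = deleteVertex G r
    colouringH : Colouring (Adj² H) (proj₁ L ∘ punchIn r , proj₂ L ∘ punchIn r)
    colouringH = choose (proj₁ L ∘ punchIn r , proj₂ L ∘ punchIn r)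
    cH = proj₁ colouringH

    outside⇒punchIn : ∀ {v} → ¬ S v → ∃ λ i → punchIn r i ≡ v
    outside⇒punchIn ¬Sv = punchOut r≢v , punchIn-punchOut r≢v
      where r≢v = λ r≡v → ¬Sv (subst S r≡v Sr)

    c∈ : ∀ v → ¬ S v → insertAt cH r 0 v ∈ proj₁ L v
    c∈ v ¬Sv with outside⇒punchIn ¬Sv
    ... | i , refl = subst (_∈ proj₁ L (punchIn r i)) (sym (insertAt-punchIn cH r 0 i))
                       (proj₁ (proj₂ colouringH) i)

    Adj²-deleteVertex : ∀ {i j} → ¬ S (punchIn r i) → ¬ S (punchIn r j) →
                        Adj² G (punchIn r i) (punchIn r j) → Adj² H i j
    Adj²-deleteVertex _ _ (i≢j , inj₁ i~j) = i≢j ∘ cong (punchIn r) , inj₁ i~j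
    Adj²-deleteVertex {i} {j} ¬Si ¬Sj (i≢j , inj₂ (w , i~w , w~j)) with r ≟ᶠ w
    ... | yes refl = contradiction (r-nbr ¬Si ¬Sj (Adj-sym G i~w) w~j) i≢j
    ... | no r≢w = i≢j ∘ cong (punchIn r) , inj₂ (punchOut r≢w ,
                     subst (Adj G (punchIn r i)) (sym (punchIn-punchOut r≢w)) i~w ,
                     subst (λ w → Adj G w (punchIn r j)) (sym (punchIn-punchOut r≢w)) w~j)

    proper : ∀ u v → ¬ S u → ¬ S v → Adj² G u v → insertAt cH r 0 u ≢ insertAt cH r 0 v
    proper u v ¬Su ¬Sv u~v with outside⇒punchIn ¬Su | outside⇒punchIn ¬Sv
    ... | i , refl | j , refl rewrite insertAt-punchIn cH r 0 i | insertAt-punchIn cH r 0 j =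
      proj₂ (proj₂ colouringH) i j (Adj²-deleteVertex ¬Su ¬Sv u~v)

Reducible : ∀ {n} → ℕ → Graph n → Set₁
Reducible {n} k G = Σ (Fin n → Set) λ S → Σ (Fin n) λ r →
  S r × AtMostOneNbrOutside G S r × Extendable (suc k) G S

MinimalBad⇒¬Reducible : ∀ {k n} {G : Graph n} → MinimalBad k G → ¬ Reducible k G
MinimalBad⇒¬Reducible {n = zero} _ (_ , () , _)
MinimalBad⇒¬Reducible {k} {suc n} {G} ((Δ≤k , χ>k+1) , minimal) (S , r , Sr , r-nbr , extendable) =
  1+n≰n (minimal n H (Δ≤k-H , χ>k+1-H))
  where
    H = deleteVertex G r
    Δ≤k-H : MaxDegLe H k
    Δ≤k-H i = ≤-trans (deg-deleteVertex G r i) (Δ≤k (punchIn r i))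
    χ>k+1-H : ListChromGt (Adj² H) (suc k)
    χ>k+1-H a a≤k+1 choose =
      χ>k+1 (suc k) ≤-refl (Choosable-deleteVertex {G = G} Sr r-nbr extendable (Choosable-mono a≤k+1 choose))

deg≤1⇒Reducible : ∀ {n k} {G : Graph n} → MaxDegLe G k → ∀ {v₀} → deg G v₀ ≤ 1 → Reducible k G
deg≤1⇒Reducible {n} {k} {G} Δ≤k {v₀} d≤1 =
  (_≡ v₀) , v₀ , refl , (λ _ _ → deg≤1⇒Adj-unique G d≤1) , λ L c-ok →
    ProperOutside-∅ G L (λ v (v≡v₀ , v≢v₀) → v≢v₀ v≡v₀)
      (proj₂ (extend-vertex G L v₀ (ball nbr?) (s≤s (ball≤k nbr?)) (ball-covers nbr?) c-ok))
  where
    nbr? : Dec (∃ (Adj G v₀))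
    nbr? = any? (λ w → adj G v₀ w Bool.≟ true)

    ball : Dec (∃ (Adj G v₀)) → List (Fin n)
    ball (yes (w , _)) = w ∷ filter (¬? ∘ (_≟ᶠ v₀)) (nbrs G w)
    ball (no _) = []

    ball≤k : ∀ d → length (ball d) ≤ k
    ball≤k (yes (w , v₀~w)) =
      ≤-trans (length-filter-nbrs G (_≟ᶠ v₀) ([] ∷ []) λ { (here refl) → Adj-sym G v₀~w , refl }) (Δ≤k w)
    ball≤k (no _) = z≤n

    ball-covers : ∀ d z → z ≢ v₀ → Adj² G v₀ z → z ∈ ball d
    ball-covers (yes (w , v₀~w)) z _ (_ , inj₁ v₀~z) = here (deg≤1⇒Adj-unique G d≤1 v₀~z v₀~w)
    ball-covers (yes (w , v₀~w)) z z≢v₀ (_ , inj₂ (y , v₀~y , y~z))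
      rewrite deg≤1⇒Adj-unique G d≤1 v₀~y v₀~w = there (∈-filter⁺ (¬? ∘ (_≟ᶠ v₀)) (Adj⇒∈nbrs G y~z) z≢v₀)
    ball-covers (no isolated) z _ (_ , inj₁ v₀~z) = contradiction (z , v₀~z) isolated
    ball-covers (no isolated) z _ (_ , inj₂ (y , v₀~y , _)) = contradiction (y , v₀~y) isolated

thread₂⇒Reducible : ∀ {n k} {G : Graph n} {x u v y} → 2 ≤ k → x ≢ v → u ≢ y →
                    Adj G x u → Adj G u v → Adj G v y → deg G u ≡ 2 → deg G v ≡ 2 →
                    deg G x ≤ k ∸ 1 → deg G y ≤ k ∸ 2 → Reducible k G
thread₂⇒Reducible {k = zero} () _ _ _ _ _ _ _ _ _
thread₂⇒Reducible {k = suc zero} (s≤s ()) _ _ _ _ _ _ _ _ _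
thread₂⇒Reducible {n} {suc (suc k)} {G} {x} {u} {v} {y} _ x≢v u≢y x~u u~v v~y du dv dx dy =
  (λ w → w ≡ u ⊎ w ≡ v) , u , inj₁ refl , u-nbr , λ L c-ok →
    ProperOutside-∅ G L (λ w (w≡v , w≢v) → w≢v w≡v)
      (proj₂ (extend-vertex G L v Fv Fv<m Fv-covers
        (ProperOutside-mono G L only-v (proj₂ (extend-vertex G L u Fu Fu<m Fu-covers c-ok)))))
  where
    S? : Decidable (λ w → w ≡ u ⊎ w ≡ v)
    S? w = (w ≟ᶠ u) ⊎-dec (w ≟ᶠ v)

    nbrs-u : ∀ {z} → Adj G u z → z ≡ x ⊎ z ≡ v
    nbrs-u = deg≡2⇒Adj-either G du x≢v (Adj-sym G x~u) u~v
    nbrs-v : ∀ {z} → Adj G v z → z ≡ u ⊎ z ≡ y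
    nbrs-v = deg≡2⇒Adj-either G dv u≢y (Adj-sym G u~v) v~y

    u-nbr : AtMostOneNbrOutside G (λ w → w ≡ u ⊎ w ≡ v) u
    u-nbr ¬Sa ¬Sb u~a u~b = trans (kept-nbr-u ¬Sa u~a) (sym (kept-nbr-u ¬Sb u~b))
      where
        kept-nbr-u : ∀ {z} → ¬ (z ≡ u ⊎ z ≡ v) → Adj G u z → z ≡ x
        kept-nbr-u ¬Sz u~z with nbrs-u u~z
        ... | inj₁ z≡x = z≡x
        ... | inj₂ z≡v = contradiction (inj₂ z≡v) ¬Sz

    Fu : List (Fin n)
    Fu = x ∷ y ∷ filter (¬? ∘ S?) (nbrs G x)
    Fu<m : length Fu < suc (suc (suc k))
    Fu<m = s≤s (s≤s (≤-trans (length-filter-nbrs G S? ([] ∷ []) λ { (here refl) → x~u , inj₁ refl }) dx))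
    Fu-covers : ∀ z → ¬ (z ≡ u ⊎ z ≡ v) → Adj² G u z → z ∈ Fu
    Fu-covers z ¬Sz (_ , inj₁ u~z) with nbrs-u u~z
    ... | inj₁ refl = here refl
    ... | inj₂ z≡v = contradiction (inj₂ z≡v) ¬Sz
    Fu-covers z ¬Sz (_ , inj₂ (w , u~w , w~z)) with nbrs-u u~w
    ... | inj₁ refl = there (there (∈-filter⁺ (¬? ∘ S?) (Adj⇒∈nbrs G w~z) ¬Sz))
    ... | inj₂ refl with nbrs-v w~z
    ...   | inj₁ z≡u = contradiction (inj₁ z≡u) ¬Sz
    ...   | inj₂ refl = there (here refl)

    only-v : ∀ {w} → (w ≡ u ⊎ w ≡ v) × w ≢ u → w ≡ v
    only-v (inj₁ w≡u , w≢u) = contradiction w≡u w≢u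
    only-v (inj₂ w≡v , _) = w≡v

    Fv : List (Fin n)
    Fv = u ∷ x ∷ y ∷ filter (¬? ∘ (_≟ᶠ v)) (nbrs G y)
    Fv<m : length Fv < suc (suc (suc k))
    Fv<m = s≤s (s≤s (s≤s (≤-trans (length-filter-nbrs G (_≟ᶠ v) ([] ∷ [])
             λ { (here refl) → Adj-sym G v~y , refl }) dy)))
    Fv-covers : ∀ z → z ≢ v → Adj² G v z → z ∈ Fv
    Fv-covers z z≢v (_ , inj₁ v~z) with nbrs-v v~z
    ... | inj₁ refl = here refl
    ... | inj₂ refl = there (there (here refl))
    Fv-covers z z≢v (_ , inj₂ (w , v~w , w~z)) with nbrs-v v~w
    ... | inj₂ refl = there (there (there (∈-filter⁺ (¬? ∘ (_≟ᶠ v)) (Adj⇒∈nbrs G w~z) z≢v)))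
    ... | inj₁ refl with nbrs-u w~z
    ...   | inj₁ refl = there (here refl)
    ...   | inj₂ z≡v = contradiction z≡v z≢v

-- If list j + 1 is contained in list j for every j, all lists equal list 0 and
-- alternating its two colours works because the cycle is even. Otherwise list j + 1
-- has a colour α outside list j: colour j + 1 with α, then walk greedily around the
-- cycle back to j, which automatically avoids α.
module EvenCycle (x y : ℕ → ℕ) (x≢y : ∀ j → x j ≢ y j) where

  _∈ₗ_ : ℕ → ℕ → Set
  α ∈ₗ j = α ≡ x j ⊎ α ≡ y j

  other : ℕ → ℕ → ℕ
  other j α with x j ≟ α
  ... | yes _ = y j
  ... | no _ = x j

  other-∈ : ∀ j α → other j α ∈ₗ j
  other-∈ j α with x j ≟ α
  ... | yes _ = inj₂ refl
  ... | no _ = inj₁ refl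

  other-≢ : ∀ j α → other j α ≢ α
  other-≢ j α with x j ≟ α
  ... | yes refl = x≢y j ∘ sym
  ... | no xj≢α = xj≢α

  other-other : ∀ j {α} → α ∈ₗ j → other j (other j α) ≡ α
  other-other j {α} α∈ with x j ≟ α
  other-other j {α} α∈ | yes refl with x j ≟ y j
  ... | yes xj≡yj = contradiction xj≡yj (x≢y j)
  ... | no _ = refl
  other-other j {α} (inj₁ refl) | no xj≢α = contradiction refl xj≢α
  other-other j {α} (inj₂ refl) | no _ with x j ≟ x j
  ... | yes _ = refl
  ... | no xj≢xj = contradiction refl xj≢xj

  walk : ℕ → ℕ → ℕ → ℕ
  walk s α zero = α
  walk s α (suc i) = other (s + suc i) (walk s α i)

  walk-∈ : ∀ s {α} → α ∈ₗ s → ∀ i → walk s α i ∈ₗ (s + i)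
  walk-∈ s α∈ zero = subst (_ ∈ₗ_) (sym (+-identityʳ s)) α∈
  walk-∈ s α∈ (suc i) = other-∈ (s + suc i) _

  walk-≢ : ∀ s α i → walk s α i ≢ walk s α (suc i)
  walk-≢ s α i = other-≢ (s + suc i) (walk s α i) ∘ sym

  CycleColouring : ℕ → (ℕ → ℕ) → Set
  CycleColouring M h = (∀ j → j ≤ M → h j ∈ₗ j) × (∀ j → j < M → h j ≢ h (suc j)) × h M ≢ h 0

  Nested : ℕ → Set
  Nested j = x (suc j) ∈ₗ j × y (suc j) ∈ₗ j

  Nested⇒⊇ : ∀ {j α} → Nested j → α ∈ₗ j → α ∈ₗ suc j
  Nested⇒⊇ {j} (inj₁ xs≡x , inj₁ ys≡x) _ = contradiction (trans xs≡x (sym ys≡x)) (x≢y (suc j))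
  Nested⇒⊇ (inj₁ xs≡x , inj₂ _) (inj₁ refl) = inj₁ (sym xs≡x)
  Nested⇒⊇ (inj₁ _ , inj₂ ys≡y) (inj₂ refl) = inj₂ (sym ys≡y)
  Nested⇒⊇ (inj₂ _ , inj₁ ys≡x) (inj₁ refl) = inj₂ (sym ys≡x)
  Nested⇒⊇ (inj₂ xs≡y , inj₁ _) (inj₂ refl) = inj₁ (sym xs≡y)
  Nested⇒⊇ {j} (inj₂ xs≡y , inj₂ ys≡y) _ = contradiction (trans xs≡y (sym ys≡y)) (x≢y (suc j))

  Nested? : ∀ j → Dec (Nested j)
  Nested? j = ((x (suc j) ≟ x j) ⊎-dec (x (suc j) ≟ y j)) ×-dec ((y (suc j) ≟ x j) ⊎-dec (y (suc j) ≟ y j))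

  all-Nested? : ∀ M → (∀ j → j < M → Nested j) ⊎ ∃ λ j → j < M × ¬ Nested j
  all-Nested? zero = inj₁ λ _ ()
  all-Nested? (suc M) with all-Nested? M
  ... | inj₂ (j , j<M , ¬N) = inj₂ (j , ≤-trans j<M (n≤1+n M) , ¬N)
  ... | inj₁ nested with Nested? M
  ...   | no ¬N = inj₂ (M , ≤-refl , ¬N)
  ...   | yes N = inj₁ λ j j<1+M → [ nested j , (λ { refl → N }) ] (m≤n⇒m<n∨m≡n (≤-pred j<1+M))

  alternating : ∀ t → (∀ j → j < suc (t * 2) → Nested j) → ∃ (CycleColouring (suc (t * 2)))
  alternating t nested = h , h∈ , (λ j _ → other-≢ 0 (h j) ∘ sym) , wrap
    where
      h : ℕ → ℕ
      h zero = x 0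
      h (suc j) = other 0 (h j)

      h∈₀ : ∀ j → h j ∈ₗ 0
      h∈₀ zero = inj₁ refl
      h∈₀ (suc j) = other-∈ 0 (h j)

      ∈ₗ-from₀ : ∀ j {α} → j ≤ suc (t * 2) → α ∈ₗ 0 → α ∈ₗ j
      ∈ₗ-from₀ zero _ α∈ = α∈
      ∈ₗ-from₀ (suc j) j<M α∈ = Nested⇒⊇ (nested j j<M) (∈ₗ-from₀ j (≤-trans (n≤1+n j) j<M) α∈)

      h∈ : ∀ j → j ≤ suc (t * 2) → h j ∈ₗ j
      h∈ j j≤M = ∈ₗ-from₀ j j≤M (h∈₀ j)

      h-even : ∀ t → h (t * 2) ≡ x 0
      h-even zero = refl
      h-even (suc t) = trans (other-other 0 (h∈₀ (t * 2))) (h-even t)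

      wrap : h (suc (t * 2)) ≢ h 0
      wrap rewrite h-even t = other-≢ 0 (x 0)

  module _ (j : ℕ) (α : ℕ) (α∈ : α ∈ₗ suc j) (α∉ : ¬ α ∈ₗ j) (d : ℕ) where

    late : ℕ → ℕ
    late = walk (suc j) α

    early : ℕ → ℕ
    early = walk 0 (other 0 (late d))

    h : ℕ → ℕ
    h i with i ≤? j
    ... | yes _ = early i
    ... | no _ = late (i ∸ suc j)

    h-early : ∀ {i} → i ≤ j → h i ≡ early i
    h-early {i} i≤j with i ≤? j
    ... | yes _ = refl
    ... | no i≰j = contradiction i≤j i≰j

    h-late : ∀ e → h (suc j + e) ≡ late e
    h-late e with suc j + e ≤? j
    ... | yes j+e<j = contradiction (≤-trans (m≤m+n (suc j) e) j+e<j) (<-irrefl refl)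
    ... | no _ = cong late (m+n∸m≡n (suc j) e)

    position : ∀ i → i ≤ j ⊎ ∃ λ e → suc j + e ≡ i
    position i with i ≤? j
    ... | yes i≤j = inj₁ i≤j
    ... | no i≰j = inj₂ (m≤n⇒∃[o]m+o≡n (≰⇒> i≰j))

    rotated : ∀ {M} → suc j + d ≡ M → CycleColouring M h
    rotated {M} refl = h∈ , h≢ , wrap
      where
        h∈ : ∀ i → i ≤ M → h i ∈ₗ i
        h∈ i _ with position i
        ... | inj₁ i≤j rewrite h-early i≤j = walk-∈ 0 (other-∈ 0 (late d)) i
        ... | inj₂ (e , refl) rewrite h-late e = walk-∈ (suc j) α∈ e

        h≢ : ∀ i → i < M → h i ≢ h (suc i)
        h≢ i _ hi≡hi+1 with position i
        ... | inj₂ (e , refl) = walk-≢ (suc j) α e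
          (trans (sym (h-late e)) (trans hi≡hi+1 (trans (cong h (sym (+-suc (suc j) e))) (h-late (suc e)))))
        ... | inj₁ i≤j with m≤n⇒m<n∨m≡n i≤j
        ...   | inj₁ i<j = walk-≢ 0 (other 0 (late d)) i
          (trans (sym (h-early i≤j)) (trans hi≡hi+1 (h-early i<j)))
        ...   | inj₂ refl = α∉ (subst (_∈ₗ i) early≡α (walk-∈ 0 (other-∈ 0 (late d)) i))
          where
            early≡α : early i ≡ α
            early≡α = trans (sym (h-early i≤j))
                        (trans hi≡hi+1 (trans (cong h (sym (+-identityʳ (suc i)))) (h-late 0)))

        wrap : h (suc j + d) ≢ h 0
        wrap rewrite h-late d | h-early {0} z≤n = other-≢ 0 (late d) ∘ sym

  evenCycle-2-choosable : ∀ t → ∃ (CycleColouring (suc (t * 2)))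
  evenCycle-2-choosable t with all-Nested? (suc (t * 2))
  ... | inj₁ nested = alternating t nested
  ... | inj₂ (j , j<M , ¬nested) with m≤n⇒∃[o]m+o≡n j<M | (x (suc j) ≟ x j) ⊎-dec (x (suc j) ≟ y j)
  ...   | d , j+d≡M | no x∉ = _ , rotated j (x (suc j)) (inj₁ refl) x∉ d j+d≡M
  ...   | d , j+d≡M | yes x∈ = _ , rotated j (y (suc j)) (inj₂ refl) (λ y∈ → ¬nested (x∈ , y∈)) d j+d≡M

≡1+⇒≢0 : ∀ {a r} → a ≡ suc r → a ≢ 0
≡1+⇒≢0 a≡1+r a≡0 = 0≢1+n (trans (sym a≡0) a≡1+r)

%-+ˡ : ∀ d {a b} m .{{_ : NonZero m}} → a % m ≡ b % m → (d + a) % m ≡ (d + b) % m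
%-+ˡ d {a} {b} m a≡b = begin
  (d + a) % m           ≡⟨ %-distribˡ-+ d a m ⟩
  (d % m + a % m) % m   ≡⟨ cong (λ r → (d % m + r) % m) a≡b ⟩
  (d % m + b % m) % m   ≡⟨ %-distribˡ-+ d b m ⟨
  (d + b) % m           ∎
  where open ≡-Reasoning

[4+n]%4≡n%4 : ∀ a → (4 + a) % 4 ≡ a % 4
[4+n]%4≡n%4 a = trans (cong (_% 4) (+-comm 4 a)) ([m+n]%n≡m%n a 4)

suc-%4-injective : ∀ {a b} → suc a % 4 ≡ suc b % 4 → a % 4 ≡ b % 4
suc-%4-injective {a} {b} eq = begin
  a % 4             ≡⟨ [4+n]%4≡n%4 a ⟨
  (3 + suc a) % 4   ≡⟨ %-+ˡ 3 {suc a} {suc b} 4 eq ⟩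
  (3 + suc b) % 4   ≡⟨ [4+n]%4≡n%4 b ⟩
  b % 4             ∎
  where open ≡-Reasoning

%4-cases : ∀ a → a % 4 ≡ 0 ⊎ a % 4 ≡ 1 ⊎ a % 4 ≡ 2 ⊎ a % 4 ≡ 3
%4-cases a with a % 4 | m%n<n a 4
... | 0 | _ = inj₁ refl
... | 1 | _ = inj₂ (inj₁ refl)
... | 2 | _ = inj₂ (inj₂ (inj₁ refl))
... | 3 | _ = inj₂ (inj₂ (inj₂ refl))
... | suc (suc (suc (suc _))) | s≤s (s≤s (s≤s (s≤s ())))

%4≢[2+n]%4 : ∀ a → a % 4 ≢ (2 + a) % 4
%4≢[2+n]%4 a a≡2+a with %4-cases a
... | inj₁ r with trans (sym r) (trans a≡2+a (%-+ˡ 2 {a} {0} 4 r))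
...   | ()
%4≢[2+n]%4 a a≡2+a | inj₂ (inj₁ r) with trans (sym r) (trans a≡2+a (%-+ˡ 2 {a} {1} 4 r))
...   | ()
%4≢[2+n]%4 a a≡2+a | inj₂ (inj₂ (inj₁ r)) with trans (sym r) (trans a≡2+a (%-+ˡ 2 {a} {2} 4 r))
...   | ()
%4≢[2+n]%4 a a≡2+a | inj₂ (inj₂ (inj₂ r)) with trans (sym r) (trans a≡2+a (%-+ˡ 2 {a} {3} 4 r))
...   | ()

%-≤-cases : ∀ {a b} m .{{_ : NonZero m}} → a ≤ m → b ≤ m → a % m ≡ b % m →
            a ≡ b ⊎ (a ≡ 0 × b ≡ m) ⊎ (a ≡ m × b ≡ 0)
%-≤-cases {a} {b} m a≤m b≤m eq with m≤n⇒m<n∨m≡n a≤m | m≤n⇒m<n∨m≡n b≤m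
... | inj₁ a<m | inj₁ b<m = inj₁ (trans (sym (m<n⇒m%n≡m a<m)) (trans eq (m<n⇒m%n≡m b<m)))
... | inj₂ refl | inj₂ refl = inj₁ refl
... | inj₁ a<m | inj₂ refl = inj₂ (inj₁ (trans (sym (m<n⇒m%n≡m a<m)) (trans eq (n%n≡0 m)) , refl))
... | inj₂ refl | inj₁ b<m = inj₂ (inj₂ (refl , trans (sym (m<n⇒m%n≡m b<m)) (trans (sym eq) (n%n≡0 m))))

⌊n*2/2⌋≡n : ∀ n → ⌊ n * 2 /2⌋ ≡ n
⌊n*2/2⌋≡n zero = refl
⌊n*2/2⌋≡n (suc n) = cong suc (⌊n*2/2⌋≡n n)

⌊1+n*2/2⌋≡n : ∀ n → ⌊ suc (n * 2) /2⌋ ≡ n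
⌊1+n*2/2⌋≡n zero = refl
⌊1+n*2/2⌋≡n (suc n) = cong suc (⌊1+n*2/2⌋≡n n)

⌊/2⌋-≡⇒≤1-apart : ∀ a b → ⌊ a /2⌋ ≡ ⌊ b /2⌋ → a ≡ b ⊎ suc a ≡ b ⊎ suc b ≡ a
⌊/2⌋-≡⇒≤1-apart 0 0 _ = inj₁ refl
⌊/2⌋-≡⇒≤1-apart 0 1 _ = inj₂ (inj₁ refl)
⌊/2⌋-≡⇒≤1-apart 1 0 _ = inj₂ (inj₂ refl)
⌊/2⌋-≡⇒≤1-apart 1 1 _ = inj₁ refl
⌊/2⌋-≡⇒≤1-apart (suc (suc a)) (suc (suc b)) eq with ⌊/2⌋-≡⇒≤1-apart a b (cong pred eq)
... | inj₁ a≡b = inj₁ (cong (λ m → suc (suc m)) a≡b)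
... | inj₂ (inj₁ 1+a≡b) = inj₂ (inj₁ (cong (λ m → suc (suc m)) 1+a≡b))
... | inj₂ (inj₂ 1+b≡a) = inj₂ (inj₂ (cong (λ m → suc (suc m)) 1+b≡a))

⌈/2⌉-≡⇒≤1-apart : ∀ a b → ⌈ a /2⌉ ≡ ⌈ b /2⌉ → a ≡ b ⊎ suc a ≡ b ⊎ suc b ≡ a
⌈/2⌉-≡⇒≤1-apart a b eq with ⌊/2⌋-≡⇒≤1-apart (suc a) (suc b) eq
... | inj₁ refl = inj₁ refl
... | inj₂ (inj₁ refl) = inj₂ (inj₁ refl)
... | inj₂ (inj₂ refl) = inj₂ (inj₂ refl)

⌈n/2⌉≡1+t⇒n≡1+t*2 : ∀ t n → n ≤ suc (t * 2) → ⌈ n /2⌉ ≡ suc t → n ≡ suc (t * 2)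
⌈n/2⌉≡1+t⇒n≡1+t*2 zero 1 _ _ = refl
⌈n/2⌉≡1+t⇒n≡1+t*2 (suc t) (suc (suc n)) (s≤s (s≤s n≤)) eq =
  cong (λ m → suc (suc m)) (⌈n/2⌉≡1+t⇒n≡1+t*2 t n n≤ (cong pred eq))
⌈n/2⌉≡1+t⇒n≡1+t*2 zero (suc (suc _)) (s≤s ()) _
⌈n/2⌉≡1+t⇒n≡1+t*2 (suc t) 1 _ ()

module ThreadCycle {n k : ℕ} (G : Graph n) (t : ℕ) (c : Fin (4 * suc t) → Fin n)
       (c-inj : ∀ i j → c i ≡ c j → i ≡ j)
       (c-adj : ∀ i j → toℕ j ≡ suc (toℕ i) % (4 * suc t) → Adj G (c i) (c j))
       (c-deg : ∀ i → (toℕ i % 4 ≡ 0 → deg G (c i) ≡ k) × (toℕ i % 4 ≢ 0 → deg G (c i) ≡ 2)) where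

  N : ℕ
  N = 4 * suc t

  pos : ℕ → Fin N
  pos q = fromℕ< (m%n<n q N)

  cyc : ℕ → Fin n
  cyc q = c (pos q)

  toℕ-pos : ∀ q → toℕ (pos q) ≡ q % N
  toℕ-pos q = toℕ-fromℕ< (m%n<n q N)

  c≡cyc : ∀ i → c i ≡ cyc (toℕ i)
  c≡cyc i = cong c (toℕ-injective (sym (trans (toℕ-pos (toℕ i)) (m<n⇒m%n≡m (toℕ<n i)))))

  cyc-≡⇒%N : ∀ {a b} → cyc a ≡ cyc b → a % N ≡ b % N
  cyc-≡⇒%N {a} {b} eq = trans (sym (toℕ-pos a)) (trans (cong toℕ (c-inj _ _ eq)) (toℕ-pos b))

  %N⇒cyc-≡ : ∀ {a b} → a % N ≡ b % N → cyc a ≡ cyc b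
  %N⇒cyc-≡ {a} {b} eq = cong c (toℕ-injective (trans (toℕ-pos a) (trans eq (sym (toℕ-pos b)))))

  %N%4 : ∀ q → q % N % 4 ≡ q % 4
  %N%4 q = m∣n⇒o%n%m≡o%m 4 N q (divides (suc t) (*-comm 4 (suc t)))

  toℕ-pos%4 : ∀ q → toℕ (pos q) % 4 ≡ q % 4
  toℕ-pos%4 q = trans (cong (_% 4) (toℕ-pos q)) (%N%4 q)

  cyc-≡⇒%4 : ∀ {a b} → cyc a ≡ cyc b → a % 4 ≡ b % 4
  cyc-≡⇒%4 {a} {b} eq = trans (sym (%N%4 a)) (trans (cong (_% 4) (cyc-≡⇒%N {a} {b} eq)) (%N%4 b))

  cyc-Adj : ∀ q → Adj G (cyc q) (cyc (suc q))
  cyc-Adj q = c-adj (pos q) (pos (suc q)) (begin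
    toℕ (pos (suc q))         ≡⟨ toℕ-pos (suc q) ⟩
    (1 + q) % N               ≡⟨ %-+ˡ 1 N (sym (m%n%n≡m%n q N)) ⟩
    (1 + q % N) % N           ≡⟨ cong (λ r → suc r % N) (sym (toℕ-pos q)) ⟩
    suc (toℕ (pos q)) % N     ∎)
    where open ≡-Reasoning

  -- `pred N` is the position just before 0 on the cycle.
  cyc-Adj⁻ : ∀ q → Adj G (cyc (q + pred N)) (cyc q)
  cyc-Adj⁻ q = subst (Adj G (cyc (q + pred N))) (%N⇒cyc-≡ {suc (q + pred N)} {q} (begin
    suc (q + pred N) % N   ≡⟨ cong (_% N) (+-suc q (pred N)) ⟨
    (q + N) % N            ≡⟨ [m+n]%n≡m%n q N ⟩
    q % N                  ∎)) (cyc-Adj (q + pred N))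
    where open ≡-Reasoning

  deg-cyc-k : ∀ q → q % 4 ≡ 0 → deg G (cyc q) ≡ k
  deg-cyc-k q q≡0 = proj₁ (c-deg (pos q)) (trans (toℕ-pos%4 q) q≡0)

  deg-cyc-2 : ∀ q → q % 4 ≢ 0 → deg G (cyc q) ≡ 2
  deg-cyc-2 q q≢0 = proj₂ (c-deg (pos q)) (q≢0 ∘ trans (sym (toℕ-pos%4 q)))

  nbrs-cyc : ∀ p → suc p % 4 ≢ 0 → ∀ {z} → Adj G (cyc (suc p)) z → z ≡ cyc p ⊎ z ≡ cyc (2 + p)
  nbrs-cyc p p+1≢0 = deg≡2⇒Adj-either G (deg-cyc-2 (suc p) p+1≢0) (%4≢[2+n]%4 p ∘ cyc-≡⇒%4 {p} {2 + p})
                       (Adj-sym G (cyc-Adj p)) (cyc-Adj (suc p))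

  AtResidue : (ℕ → Set) → Fin n → Set
  AtResidue R w = ∃ λ i → c i ≡ w × R (toℕ i % 4)

  AtResidue? : ∀ {R} → (∀ r → Dec (R r)) → Decidable (AtResidue R)
  AtResidue? R? w = any? λ i → (c i ≟ᶠ w) ×-dec R? (toℕ i % 4)

  cyc∈ : ∀ {R} q → R (q % 4) → AtResidue R (cyc q)
  cyc∈ {R} q r = pos q , refl , subst R (sym (toℕ-pos%4 q)) r

  ∈cyc : ∀ {R} q → AtResidue R (cyc q) → R (q % 4)
  ∈cyc {R} q (i , ci≡ , r) = subst R (cyc-≡⇒%4 {toℕ i} {q} (trans (sym (c≡cyc i)) ci≡)) r

  -- Position 4i has degree k and positions 4i + 1, 4i + 2, 4i + 3 form a thread:
  -- two ends at odd positions around a middle.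
  OddResidue : ℕ → Set
  OddResidue r = r ≡ 1 ⊎ r ≡ 3

  Removed Odd Middle : Fin n → Set
  Removed = AtResidue (_≢ 0)
  Odd = AtResidue OddResidue
  Middle = AtResidue (_≡ 2)

  Removed? : Decidable Removed
  Removed? = AtResidue? λ r → ¬? (r ℕ.≟ 0)

  Odd? : Decidable Odd
  Odd? = AtResidue? λ r → (r ℕ.≟ 1) ⊎-dec (r ℕ.≟ 3)

  Middle? : Decidable Middle
  Middle? = AtResidue? (ℕ._≟ 2)

  cyc-Removed : ∀ q {r} → q % 4 ≡ suc r → Removed (cyc q)
  cyc-Removed q q≡1+r = cyc∈ {_≢ 0} q (≡1+⇒≢0 q≡1+r)

  cyc1-nbr : AtMostOneNbrOutside G Removed (cyc 1)
  cyc1-nbr ¬Ru ¬Rv c1~u c1~v = trans (only-kept-nbr ¬Ru c1~u) (sym (only-kept-nbr ¬Rv c1~v))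
    where
      only-kept-nbr : ∀ {z} → ¬ Removed z → Adj G (cyc 1) z → z ≡ cyc 0
      only-kept-nbr ¬Rz c1~z with nbrs-cyc 0 (λ ()) c1~z
      ... | inj₁ z≡c0 = z≡c0
      ... | inj₂ refl = contradiction (cyc-Removed 2 refl) ¬Rz

  middle-offset : ∀ p → (2 + p) % 4 ≡ 2 → p % 4 ≡ 0
  middle-offset p eq = suc-%4-injective {p} {0} (suc-%4-injective {suc p} {1} eq)

  nbrs-middle : ∀ p → (2 + p) % 4 ≡ 2 → ∀ {z} → Adj G (cyc (2 + p)) z → z ≡ cyc (1 + p) ⊎ z ≡ cyc (3 + p)
  nbrs-middle p eq = nbrs-cyc (suc p) (≡1+⇒≢0 eq)

  nbr-of-middle-Removed : ∀ p → (2 + p) % 4 ≡ 2 → ∀ {z} → Adj G (cyc (2 + p)) z → Removed z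
  nbr-of-middle-Removed p eq m~z with nbrs-middle p eq m~z
  ... | inj₁ refl = cyc-Removed (1 + p) (%-+ˡ 1 {p} {0} 4 (middle-offset p eq))
  ... | inj₂ refl = cyc-Removed (3 + p) (%-+ˡ 3 {p} {0} 4 (middle-offset p eq))

  window : ℕ → List (Fin n)
  window (suc (suc p)) = cyc p ∷ cyc (1 + p) ∷ cyc (3 + p) ∷ cyc (4 + p) ∷ []
  window _ = []

  length-window : ∀ q → length (window q) ≤ 4
  length-window (suc (suc p)) = ≤-refl
  length-window 0 = z≤n
  length-window 1 = z≤n

  window-covers : ∀ q → q % 4 ≡ 2 → ∀ {z} → Adj² G (cyc q) z → z ∈ window q
  window-covers (suc (suc p)) eq (_ , inj₁ m~z) with nbrs-middle p eq m~z
  ... | inj₁ refl = there (here refl)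
  ... | inj₂ refl = there (there (here refl))
  window-covers (suc (suc p)) eq (m≢z , inj₂ (w , m~w , w~z)) with nbrs-middle p eq m~w
  ... | inj₁ refl with nbrs-cyc p (≡1+⇒≢0 (%-+ˡ 1 {p} {0} 4 (middle-offset p eq))) w~z
  ...   | inj₁ refl = here refl
  ...   | inj₂ z≡m = contradiction (sym z≡m) m≢z
  window-covers (suc (suc p)) eq (m≢z , inj₂ (w , m~w , w~z)) | inj₂ refl
    with nbrs-cyc (2 + p) (≡1+⇒≢0 (%-+ˡ 3 {p} {0} 4 (middle-offset p eq))) w~z
  ...   | inj₁ z≡m = contradiction (sym z≡m) m≢z
  ...   | inj₂ refl = there (there (there (here refl)))

  window-¬Middle : ∀ q → q % 4 ≡ 2 → ∀ {z} → z ∈ window q → ¬ Middle z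
  window-¬Middle (suc (suc p)) eq (here refl) Mz
    with trans (sym (middle-offset p eq)) (∈cyc {_≡ 2} p Mz)
  ... | ()
  window-¬Middle (suc (suc p)) eq (there (here refl)) Mz
    with trans (sym (%-+ˡ 1 {p} {0} 4 (middle-offset p eq))) (∈cyc {_≡ 2} (1 + p) Mz)
  ... | ()
  window-¬Middle (suc (suc p)) eq (there (there (here refl))) Mz
    with trans (sym (%-+ˡ 3 {p} {0} 4 (middle-offset p eq))) (∈cyc {_≡ 2} (3 + p) Mz)
  ... | ()
  window-¬Middle (suc (suc p)) eq (there (there (there (here refl)))) Mz
    with trans (sym (trans ([4+n]%4≡n%4 p) (middle-offset p eq))) (∈cyc {_≡ 2} (4 + p) Mz)
  ... | ()

  module _ (4≤k : 4 ≤ k) (L : ListAssignment n (suc k)) where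

    colour-middles : ∀ {c} → ProperOutside G L Middle c → Colouring (Adj² G) L
    colour-middles c-ok = ProperOutside-∅ G L (λ v (Mv , ¬Mv) → ¬Mv Mv)
      (Greedy.colouring G L Middle? window-of (λ { x (i , _) → s≤s (≤-trans (length-window (toℕ i)) 4≤k) })
        (λ x Mx z _ → covers Mx) independent c-ok)
      where
        window-of : ∀ x → Middle x → List (Fin n)
        window-of x (i , _ , _) = window (toℕ i)
        covers : ∀ {x z} (Mx : Middle x) → Adj² G x z → z ∈ window-of x Mx
        covers {z = z} (i , refl , i≡2) x~z = window-covers (toℕ i) i≡2 (subst (λ v → Adj² G v z) (c≡cyc i) x~z)
        independent : ∀ x y → Middle x → Middle y → ¬ Adj² G x y
        independent x y Mx@(i , _ , i≡2) My x~y = window-¬Middle (toℕ i) i≡2 (covers Mx x~y) My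

  -- The E ends sit at the odd positions 2j + 1. End j is adjacent to its anchor
  -- (the degree-k vertex at 4⌈j/2⌉) and to its thread middle (at 2 + 4⌊j/2⌋);
  -- consecutive ends share one of these, which makes the ends a cycle in G².
  E : ℕ
  E = suc t * 2

  oddPos anchorPos middlePos : ℕ → ℕ
  oddPos j = suc (j * 2)
  anchorPos j = 4 * ⌈ j /2⌉
  middlePos j = 2 + 4 * ⌊ j /2⌋

  end anchor mid : ℕ → Fin n
  end = cyc ∘ oddPos
  anchor = cyc ∘ anchorPos
  mid = cyc ∘ middlePos

  anchorPos-+2 : ∀ j → anchorPos (2 + j) ≡ 4 + anchorPos j
  anchorPos-+2 j = *-suc 4 ⌈ j /2⌉

  middlePos-+2 : ∀ j → middlePos (2 + j) ≡ 4 + middlePos j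
  middlePos-+2 j = cong (2 +_) (*-suc 4 ⌊ j /2⌋)

  around-end : ∀ j → (anchorPos j ≡ j * 2 × middlePos j ≡ 2 + j * 2) ⊎
                     (middlePos j ≡ j * 2 × anchorPos j ≡ 2 + j * 2)
  around-end 0 = inj₁ (refl , refl)
  around-end 1 = inj₂ (refl , refl)
  around-end (suc (suc j)) with around-end j
  ... | inj₁ (a , m) = inj₁ (trans (anchorPos-+2 j) (cong (4 +_) a) , trans (middlePos-+2 j) (cong (4 +_) m))
  ... | inj₂ (m , a) = inj₂ (trans (middlePos-+2 j) (cong (4 +_) m) , trans (anchorPos-+2 j) (cong (4 +_) a))

  anchorPos%4 : ∀ j → anchorPos j % 4 ≡ 0
  anchorPos%4 j = trans (cong (_% 4) (*-comm 4 ⌈ j /2⌉)) (m*n%n≡0 ⌈ j /2⌉ 4)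

  middlePos%4 : ∀ j → middlePos j % 4 ≡ 2
  middlePos%4 j = trans (cong (λ m → (2 + m) % 4) (*-comm 4 ⌊ j /2⌋)) ([m+kn]%n≡m%n 2 ⌊ j /2⌋ 4)

  oddPos%4 : ∀ j → OddResidue (oddPos j % 4)
  oddPos%4 j with around-end j
  ... | inj₁ (a , _) = inj₁ (subst (λ m → suc m % 4 ≡ 1) a (%-+ˡ 1 {anchorPos j} {0} 4 (anchorPos%4 j)))
  ... | inj₂ (m , _) = inj₂ (subst (λ m → suc m % 4 ≡ 3) m (%-+ˡ 1 {middlePos j} {2} 4 (middlePos%4 j)))

  OddResidue⇒≢0 : ∀ {r} → OddResidue r → r ≢ 0
  OddResidue⇒≢0 (inj₁ refl) ()
  OddResidue⇒≢0 (inj₂ refl) ()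

  OddResidue⇒≢2 : ∀ {r} → OddResidue r → r ≢ 2
  OddResidue⇒≢2 (inj₁ refl) ()
  OddResidue⇒≢2 (inj₂ refl) ()

  nbrs-end : ∀ j {z} → Adj G (end j) z → z ≡ anchor j ⊎ z ≡ mid j
  nbrs-end j e~z with nbrs-cyc (j * 2) (OddResidue⇒≢0 (oddPos%4 j)) e~z | around-end j
  ... | inj₁ refl | inj₁ (a , _) = inj₁ (cong cyc (sym a))
  ... | inj₂ refl | inj₁ (_ , m) = inj₂ (cong cyc (sym m))
  ... | inj₁ refl | inj₂ (m , _) = inj₂ (cong cyc (sym m))
  ... | inj₂ refl | inj₂ (_ , a) = inj₁ (cong cyc (sym a))

  forbidden : ℕ → List (Fin n)
  forbidden j = anchor j ∷ filter (¬? ∘ Removed?) (nbrs G (anchor j))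

  length-forbidden : ∀ j → 2 + length (forbidden j) ≤ suc k
  length-forbidden j = s≤s (subst (2 + length (filter (¬? ∘ Removed?) (nbrs G (anchor j))) ≤_)
    (deg-cyc-k A (anchorPos%4 j))
    (length-filter-nbrs G Removed? ((distinct ∷ []) ∷ [] ∷ [])
      λ { (here refl) → cyc-Adj A , cyc-Removed (suc A) A+1%4
        ; (there (here refl)) → Adj-sym G (cyc-Adj⁻ A) , cyc-Removed (A + pred N) A-1%4 }))
    where
      A = anchorPos j
      A+1%4 : suc A % 4 ≡ 1
      A+1%4 = %-+ˡ 1 {A} {0} 4 (anchorPos%4 j)
      A-1%4 : (A + pred N) % 4 ≡ 3
      A-1%4 = suc-%4-injective {A + pred N} {3} (begin
        suc (A + pred N) % 4   ≡⟨ cong (_% 4) (+-suc A (pred N)) ⟨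
        (A + N) % 4            ≡⟨ cong (λ m → (A + m) % 4) (*-comm 4 (suc t)) ⟩
        (A + suc t * 4) % 4    ≡⟨ [m+kn]%n≡m%n A (suc t) 4 ⟩
        A % 4                  ≡⟨ anchorPos%4 j ⟩
        0                      ∎)
        where open ≡-Reasoning
      distinct : cyc (suc A) ≢ cyc (A + pred N)
      distinct eq with trans (sym A+1%4) (trans (cyc-≡⇒%4 {suc A} {A + pred N} eq) A-1%4)
      ... | ()

  forbidden-covers : ∀ j z → ¬ Removed z → Adj² G (end j) z → z ∈ forbidden j
  forbidden-covers j z ¬Rz (_ , inj₁ e~z) with nbrs-end j e~z
  ... | inj₁ refl = here refl
  ... | inj₂ refl = contradiction (cyc-Removed (middlePos j) (middlePos%4 j)) ¬Rz
  forbidden-covers j z ¬Rz (_ , inj₂ (w , e~w , w~z)) with nbrs-end j e~w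
  ... | inj₁ refl = there (∈-filter⁺ (¬? ∘ Removed?) (Adj⇒∈nbrs G w~z) ¬Rz)
  ... | inj₂ refl = contradiction (nbr-of-middle-Removed (4 * ⌊ j /2⌋) (middlePos%4 j) w~z) ¬Rz

  N≡E*2 : N ≡ E * 2
  N≡E*2 = sym (trans (*-assoc (suc t) 2 2) (*-comm (suc t) 4))

  OddResidue⇒%2 : ∀ q → OddResidue (q % 4) → q % 2 ≡ 1
  OddResidue⇒%2 q odd = trans (sym (m∣n⇒o%n%m≡o%m 2 4 q (divides 2 refl))) (residue-%2 odd)
    where
      residue-%2 : ∀ {r} → OddResidue r → r % 2 ≡ 1
      residue-%2 (inj₁ refl) = refl
      residue-%2 (inj₂ refl) = refl

  Odd⇒end : ∀ i → OddResidue (toℕ i % 4) → c i ≡ end (toℕ i / 2) × toℕ i / 2 < E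
  Odd⇒end i odd = trans (c≡cyc i) (cong cyc i≡odd) , m<n*o⇒m/o<n (subst (toℕ i <_) N≡E*2 (toℕ<n i))
    where
      i≡odd : toℕ i ≡ oddPos (toℕ i / 2)
      i≡odd = trans (m≡m%n+[m/n]*n (toℕ i) 2) (cong (_+ toℕ i / 2 * 2) (OddResidue⇒%2 (toℕ i) odd))

  Consecutive : ℕ → ℕ → Set
  Consecutive j j' = suc j ≡ j' ⊎ (suc j ≡ E × j' ≡ 0)

  ≤1-apart⇒Consecutive : ∀ {j j'} → j ≡ j' ⊎ suc j ≡ j' ⊎ suc j' ≡ j → j ≡ j' ⊎ Consecutive j j' ⊎ Consecutive j' j
  ≤1-apart⇒Consecutive (inj₁ j≡j') = inj₁ j≡j'
  ≤1-apart⇒Consecutive (inj₂ (inj₁ 1+j≡j')) = inj₂ (inj₁ (inj₁ 1+j≡j'))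
  ≤1-apart⇒Consecutive (inj₂ (inj₂ 1+j'≡j)) = inj₂ (inj₂ (inj₁ 1+j'≡j))

  anchorPos≤N : ∀ {j} → j < E → anchorPos j ≤ N
  anchorPos≤N j<E = *-monoʳ-≤ 4 (≤-trans (⌈n/2⌉-mono (≤-pred j<E)) (≤-reflexive (cong suc (⌊n*2/2⌋≡n t))))

  anchorPos≡0⇒j≡0 : ∀ {j} → anchorPos j ≡ 0 → j ≡ 0
  anchorPos≡0⇒j≡0 {zero} _ = refl

  anchorPos≡N⇒1+j≡E : ∀ {j} → j < E → anchorPos j ≡ N → suc j ≡ E
  anchorPos≡N⇒1+j≡E {j} j<E a≡N = cong suc (⌈n/2⌉≡1+t⇒n≡1+t*2 t j (≤-pred j<E) (*-cancelˡ-≡ _ _ 4 a≡N))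

  anchors-meet : ∀ {j j'} → j < E → j' < E → anchor j ≡ anchor j' → j ≡ j' ⊎ Consecutive j j' ⊎ Consecutive j' j
  anchors-meet {j} {j'} j<E j'<E eq
    with %-≤-cases N (anchorPos≤N j<E) (anchorPos≤N j'<E) (cyc-≡⇒%N {anchorPos j} {anchorPos j'} eq)
  ... | inj₁ eq' = ≤1-apart⇒Consecutive (⌈/2⌉-≡⇒≤1-apart j j' (*-cancelˡ-≡ _ _ 4 eq'))
  ... | inj₂ (inj₁ (a≡0 , a'≡N)) = inj₂ (inj₂ (inj₂ (anchorPos≡N⇒1+j≡E j'<E a'≡N , anchorPos≡0⇒j≡0 a≡0)))
  ... | inj₂ (inj₂ (a≡N , a'≡0)) = inj₂ (inj₁ (inj₂ (anchorPos≡N⇒1+j≡E j<E a≡N , anchorPos≡0⇒j≡0 a'≡0)))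

  middlePos<N : ∀ {j} → j < E → middlePos j < N
  middlePos<N {j} j<E = begin-strict
    2 + 4 * ⌊ j /2⌋   ≤⟨ +-monoʳ-≤ 2 (*-monoʳ-≤ 4 (≤-trans (⌊n/2⌋-mono (≤-pred j<E)) (≤-reflexive (⌊1+n*2/2⌋≡n t)))) ⟩
    2 + 4 * t         <⟨ s≤s (s≤s (s≤s (n≤1+n (4 * t)))) ⟩
    4 + 4 * t         ≡⟨ *-suc 4 t ⟨
    N                 ∎
    where open ℕ.≤-Reasoning

  middles-meet : ∀ {j j'} → j < E → j' < E → mid j ≡ mid j' → j ≡ j' ⊎ Consecutive j j' ⊎ Consecutive j' j
  middles-meet {j} {j'} j<E j'<E eq =
    ≤1-apart⇒Consecutive (⌊/2⌋-≡⇒≤1-apart j j' (*-cancelˡ-≡ _ _ 4 (+-cancelˡ-≡ 2 _ _ m≡m')))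
    where
      m≡m' : middlePos j ≡ middlePos j'
      m≡m' = trans (sym (m<n⇒m%n≡m (middlePos<N j<E)))
               (trans (cyc-≡⇒%N {middlePos j} {middlePos j'} eq) (m<n⇒m%n≡m (middlePos<N j'<E)))

  distinct-ends : ∀ {j j'} {A : Set} → end j ≢ end j' → j ≡ j' ⊎ A → A
  distinct-ends e≢e' (inj₁ refl) = contradiction refl e≢e'
  distinct-ends _ (inj₂ a) = a

  ends-Adj²⇒Consecutive : ∀ {j j'} → j < E → j' < E → Adj² G (end j) (end j') → Consecutive j j' ⊎ Consecutive j' j
  ends-Adj²⇒Consecutive {j} {j'} _ _ (_ , inj₁ e~e') with nbrs-end j e~e'
  ... | inj₁ e'≡a = contradiction (trans (cyc-≡⇒%4 {oddPos j'} {anchorPos j} e'≡a) (anchorPos%4 j))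
                      (OddResidue⇒≢0 (oddPos%4 j'))
  ... | inj₂ e'≡m = contradiction (trans (cyc-≡⇒%4 {oddPos j'} {middlePos j} e'≡m) (middlePos%4 j))
                      (OddResidue⇒≢2 (oddPos%4 j'))
  ends-Adj²⇒Consecutive {j} {j'} j<E j'<E (e≢e' , inj₂ (w , e~w , w~e'))
    with nbrs-end j e~w | nbrs-end j' (Adj-sym G w~e')
  ... | inj₁ refl | inj₁ a≡a' = distinct-ends e≢e' (anchors-meet j<E j'<E a≡a')
  ... | inj₂ refl | inj₂ m≡m' = distinct-ends e≢e' (middles-meet j<E j'<E m≡m')
  ... | inj₁ refl | inj₂ a≡m'
    with trans (sym (anchorPos%4 j)) (trans (cyc-≡⇒%4 {anchorPos j} {middlePos j'} a≡m') (middlePos%4 j'))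
  ...   | ()
  ends-Adj²⇒Consecutive {j} {j'} j<E j'<E (e≢e' , inj₂ (w , e~w , w~e')) | inj₂ refl | inj₁ m≡a'
    with trans (sym (middlePos%4 j)) (trans (cyc-≡⇒%4 {middlePos j} {anchorPos j'} m≡a') (anchorPos%4 j'))
  ...   | ()

  module _ (Lst : ListAssignment n (suc k)) (col : Fin n → ℕ) where

    Available : ℕ → ℕ → Set
    Available j α = α ∈ proj₁ Lst (end j) × α ∉ map col (forbidden j)

    opaque
      two-available : ∀ j → ∃ λ α → ∃ λ β → α ≢ β × Available j α × Available j β
      two-available j = longer⇒∃₂∉ ℕ._≟_ (proj₁ (proj₂ Lst (end j)))
        (subst₂ _≤_ (cong (2 +_) (sym (length-map col (forbidden j)))) (sym (proj₂ (proj₂ Lst (end j))))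
          (length-forbidden j))

    open EvenCycle (proj₁ ∘ two-available) (proj₁ ∘ proj₂ ∘ two-available)
                   (proj₁ ∘ proj₂ ∘ proj₂ ∘ two-available)
      using (evenCycle-2-choosable)

    h : ℕ → ℕ
    h = proj₁ (evenCycle-2-choosable t)

    h-Available : ∀ {j} → j < E → Available j (h j)
    h-Available {j} j<E =
      [ (λ hj≡x → subst (Available j) (sym hj≡x) (proj₁ (proj₂ (proj₂ (proj₂ (two-available j))))))
      , (λ hj≡y → subst (Available j) (sym hj≡y) (proj₂ (proj₂ (proj₂ (proj₂ (two-available j))))))
      ] (proj₁ (proj₂ (evenCycle-2-choosable t)) j (≤-pred j<E))

    h-Consecutive : ∀ {j j'} → j' < E → Consecutive j j' → h j ≢ h j'
    h-Consecutive {j} j'<E (inj₁ refl) = proj₁ (proj₂ (proj₂ (evenCycle-2-choosable t))) j (≤-pred j'<E)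
    h-Consecutive _ (inj₂ (refl , refl)) = proj₂ (proj₂ (proj₂ (evenCycle-2-choosable t)))

    φ : Fin n → ℕ
    φ w with Odd? w
    ... | yes (i , _ , _) = h (toℕ i / 2)
    ... | no _ = 0

    φ-end : ∀ {w} → Odd w → ∃ λ j → j < E × w ≡ end j × φ w ≡ h j
    φ-end {w} Ow with Odd? w
    ... | yes (i , ci≡w , odd) = toℕ i / 2 , proj₂ (Odd⇒end i odd) , trans (sym ci≡w) (proj₁ (Odd⇒end i odd)) , refl
    ... | no ¬Ow = contradiction Ow ¬Ow

    colour-ends : ProperOutside G Lst Removed col →
                  ProperOutside G Lst (λ v → Removed v × ¬ Odd v) (override G Lst Odd? φ col)
    colour-ends c-ok = extend G Lst Odd? c-ok φ∈ φ≢col φ≢φ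
      where
        φ∈ : ∀ x → Odd x → φ x ∈ proj₁ Lst x
        φ∈ x Ox with φ-end Ox
        ... | j , j<E , refl , φx≡hj rewrite φx≡hj = proj₁ (h-Available j<E)
        φ≢col : ∀ x z → Odd x → ¬ Removed z → Adj² G x z → φ x ≢ col z
        φ≢col x z Ox ¬Rz x~z with φ-end Ox
        ... | j , j<E , refl , φx≡hj rewrite φx≡hj = λ hj≡cz → proj₂ (h-Available j<E)
          (subst (_∈ map col (forbidden j)) (sym hj≡cz) (∈-map⁺ col (forbidden-covers j z ¬Rz x~z)))
        φ≢φ : ∀ x y → Odd x → Odd y → Adj² G x y → φ x ≢ φ y
        φ≢φ x y Ox Oy x~y with φ-end Ox | φ-end Oy
        ... | j , j<E , refl , φx≡hj | j' , j'<E , refl , φy≡hj' rewrite φx≡hj | φy≡hj'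
          with ends-Adj²⇒Consecutive j<E j'<E x~y
        ... | inj₁ j→j' = h-Consecutive j'<E j→j'
        ... | inj₂ j'→j = h-Consecutive j<E j'→j ∘ sym

  Removed∖Odd⇒Middle : ∀ {w} → Removed w × ¬ Odd w → Middle w
  Removed∖Odd⇒Middle ((i , ci≡w , i≢0) , ¬Ow) with %4-cases (toℕ i)
  ... | inj₁ i≡0 = contradiction i≡0 i≢0
  ... | inj₂ (inj₁ i≡1) = contradiction (i , ci≡w , inj₁ i≡1) ¬Ow
  ... | inj₂ (inj₂ (inj₁ i≡2)) = i , ci≡w , i≡2
  ... | inj₂ (inj₂ (inj₂ i≡3)) = contradiction (i , ci≡w , inj₂ i≡3) ¬Ow

  reducible : 4 ≤ k → Reducible k G
  reducible 4≤k = Removed , cyc 1 , cyc-Removed 1 refl , cyc1-nbr , λ Lst c-ok →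
    colour-middles 4≤k Lst (ProperOutside-mono G Lst Removed∖Odd⇒Middle (colour-ends Lst _ c-ok))

lemma3p2 : (k : ℕ) → 4 ≤ k → {n : ℕ} → (G : Graph n) → MinimalBad k G →
    (∀ (v : Fin n) → 2 ≤ deg G v) × ¬ ConfigB k G × ¬ ConfigC k G
lemma3p2 k 4≤k G minimal@((Δ≤k , _) , _) = 2≤deg , ¬ConfigB , ¬ConfigC
  where
    irreducible : ¬ Reducible k G
    irreducible = MinimalBad⇒¬Reducible {G = G} minimal

    2≤deg : ∀ v → 2 ≤ deg G v
    2≤deg v with 2 ≤? deg G v
    ... | yes 2≤d = 2≤d
    ... | no 2≰d = contradiction (deg≤1⇒Reducible {G = G} Δ≤k (≤-pred (≰⇒> 2≰d))) irreducible

    ¬ConfigB : ¬ ConfigB k G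
    ¬ConfigB (_ , _ , _ , _ , (_ , x≢v , _ , _ , u≢y , _) , (x~u , u~v , v~y) , (du , dv , dx , dy)) =
      irreducible (thread₂⇒Reducible {G = G} (≤-trans (s≤s (s≤s z≤n)) 4≤k) x≢v u≢y x~u u~v v~y du dv dx dy)

    ¬ConfigC : ¬ ConfigC k G
    ¬ConfigC (t , c , c-inj , c-adj , c-deg) = irreducible (ThreadCycle.reducible {k = k} G t c c-inj c-adj c-deg 4≤k)
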